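{- For a hypergraph $H$ and a subset $B\subseteq V(H)$, $B$ is a lazy burning set for $H$ if and only if $B\cup E(H)$ is a zero forcing set for $\mathrm{IG}(H)$.
   Context: A hypergraph $H$ consists of a finite vertex set $V(H)$ and a finite collection $E(H)$ of nonempty subsets of $V(H)$. Lazy burning: a set $B\subseteq V(H)$ is burned initially; in each subsequent round every unburned vertex $v$ for which some hyperedge $h\ni v$ has $h\setminus\{v\}$ entirely burned becomes burned. $B$ is a lazy burning set if eventually all vertices burn. The incidence graph $\mathrm{IG}(H)$ is the bipartite graph on $V(H)\cup E(H)$ with $v\in V(H)$ adjacent to $h\in E(H)$ iff $v\in h$. Zero forcing on a graph $G$: an initial set of vertices is black, the rest white; repeatedly, a black vertex $u$ with exactly one white neighbor $w$ turns $w$ black. A zero forcing set is an initial black set from which all vertices eventually become black. -}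

module Defs where

open import Data.Nat using (ℕ; zero; suc; _+_)
open import Data.Fin using (Fin; splitAt)
open import Data.Fin.Subset using (Subset; _∈_; _∉_; Nonempty; inside)
open import Data.Vec using (_++_; replicate; _[_]≔_)
open import Data.Product using (Σ; ∃; _×_; _,_)
open import Data.Sum using (_⊎_; inj₁; inj₂)
open import Data.Empty using (⊥)
open import Relation.Binary.PropositionalEquality using (_≡_; _≢_)
open import Relation.Binary.Construct.Closure.ReflexiveTransitive using (Star)

record Hypergraph : Set where
  field
    n        : ℕ
    m        : ℕ
    edge     : Fin m → Subset n
    nonempty : ∀ h → Nonempty (edge h)

open Hypergraph public

Burned : (H : Hypergraph) → Subset (n H) → ℕ → Fin (n H) → Set
Burned H B zero    v = v ∈ B
Burned H B (suc k) v =
  Burned H B k v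
  ⊎ (Σ (Fin (m H)) λ h → v ∈ edge H h
       × (∀ u → u ∈ edge H h → u ≢ v → Burned H B k u))

IsLazyBurningSet : (H : Hypergraph) → Subset (n H) → Set
IsLazyBurningSet H B = ∃ λ k → ∀ v → Burned H B k v

record Graph : Set₁ where
  field
    N   : ℕ
    Adj : Fin N → Fin N → Set

open Graph public

ForceStep : (G : Graph) → Subset (N G) → Subset (N G) → Set
ForceStep G S S' =
  Σ (Fin (N G)) λ u → Σ (Fin (N G)) λ w →
    u ∈ S × Adj G u w × w ∉ S
    × (∀ x → Adj G u x → x ≢ w → x ∈ S)
    × S' ≡ (S [ w ]≔ inside)

AllBlack : (G : Graph) → Subset (N G) → Set
AllBlack G S = ∀ x → x ∈ S

IsZeroForcingSet : (G : Graph) → Subset (N G) → Set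
IsZeroForcingSet G S =
  Σ (Subset (N G)) λ S' → Star (ForceStep G) S S' × AllBlack G S'

-- Incidence graph IG(H): vertices Fin (n + m); the first n are the
-- vertices of H (via splitAt, inj₁ v), the last m the hyperedges (inj₂ h).

IGAdj′ : (H : Hypergraph) → Fin (n H) ⊎ Fin (m H) → Fin (n H) ⊎ Fin (m H) → Set
IGAdj′ H (inj₁ v) (inj₂ h) = v ∈ edge H h
IGAdj′ H (inj₂ h) (inj₁ v) = v ∈ edge H h
IGAdj′ H (inj₁ _) (inj₁ _) = ⊥
IGAdj′ H (inj₂ _) (inj₂ _) = ⊥

IG : Hypergraph → Graph
IG H = record
  { N   = n H + m H
  ; Adj = λ a b → IGAdj′ H (splitAt (n H) a) (splitAt (n H) b)
  }

_∪E : {H : Hypergraph} → Subset (n H) → Subset (N (IG H))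
_∪E {H} B = B ++ replicate (m H) inside

-- In IG(H) with every hyperedge node black, only vertex nodes can be forced, and only by hyperedge
-- nodes; a hyperedge h forces v exactly when v is the last white vertex of h, which is the lazy
-- burning rule. So each round of burning can be replayed as a sequence of forces, and conversely
-- along any forcing sequence from B ∪ E(H) every black vertex node is a vertex that burns.
module Submission where

open import Defs
open import Data.Fin.Subset using (Subset)
open import Function.Bundles using (_⇔_)

open import Data.Nat using (zero; suc)
open import Data.Fin using (Fin; zero; suc; splitAt; _↑ˡ_; _↑ʳ_; _≟_)
open import Data.Fin.Properties using (splitAt-↑ˡ; splitAt-↑ʳ; splitAt⁻¹-↑ˡ; splitAt⁻¹-↑ʳ; ↑ˡ-injective; any?; all?)
open import Data.Fin.Subset using (_∈_; _∉_; _⊆_; inside)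
open import Data.Fin.Subset.Properties using (_∈?_; ⊆-refl; ⊆-trans)
open import Data.Vec using (Vec; []; _∷_; _++_; replicate; _[_]=_; _[_]≔_; here; there)
open import Data.Vec.Properties using ([]=⇒lookup; lookup⇒[]=; lookup∘update′; []≔-updates; []≔-minimal; []≔-++-↑ˡ)
open import Data.List using (List; []; _∷_; allFin; filter)
open import Data.List.Relation.Unary.All as All using (All; []; _∷_)
open import Data.List.Relation.Unary.All.Properties using (all-filter)
open import Data.List.Membership.Propositional.Properties using (∈-allFin; ∈-filter⁺)
open import Data.Product using (∃-syntax; _×_; _,_)
open import Data.Sum using (_⊎_; inj₁; inj₂)
open import Data.Empty using (⊥-elim)
open import Function using (id; _∘_)
open import Function.Bundles using (mk⇔)
open import Relation.Nullary using (¬_; yes; no)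
open import Relation.Nullary.Decidable using (¬?; _×-dec_; _→-dec_)
open import Relation.Unary using (Decidable)
open import Relation.Binary using (Rel; _Respects_)
open import Relation.Binary.PropositionalEquality using (_≡_; _≢_; refl; sym; trans; cong; cong₂; subst)
open import Relation.Binary.Construct.Closure.ReflexiveTransitive using (Star; ε; _◅_; _◅◅_)

Star-resp : ∀ {a r p} {A : Set a} {R : Rel A r} {P : A → Set p} →
  P Respects R → P Respects Star R
Star-resp resp ε         = id
Star-resp resp (r ◅ rs) = Star-resp resp rs ∘ resp r

module _ {a} {A : Set a} where

  []=-++⁺ˡ : ∀ {m n} {xs : Vec A m} {ys : Vec A n} {i x} →
    xs [ i ]= x → (xs ++ ys) [ i ↑ˡ n ]= x
  []=-++⁺ˡ here      = here
  []=-++⁺ˡ (there p) = there ([]=-++⁺ˡ p)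

  []=-++⁻ˡ : ∀ {m n} {xs : Vec A m} {ys : Vec A n} {i x} →
    (xs ++ ys) [ i ↑ˡ n ]= x → xs [ i ]= x
  []=-++⁻ˡ {xs = _ ∷ _} {i = zero}  here      = here
  []=-++⁻ˡ {xs = _ ∷ _} {i = suc i} (there p) = there ([]=-++⁻ˡ p)

  []=-++⁺ʳ : ∀ {m n} (xs : Vec A m) {ys : Vec A n} {j y} →
    ys [ j ]= y → (xs ++ ys) [ m ↑ʳ j ]= y
  []=-++⁺ʳ []       p = p
  []=-++⁺ʳ (_ ∷ xs) p = there ([]=-++⁺ʳ xs p)

  []=-replicate : ∀ {n} (i : Fin n) {x : A} → replicate n x [ i ]= x
  []=-replicate zero    = here
  []=-replicate (suc i) = there ([]=-replicate i)

module _ {n} (p : Subset n) (x : Fin n) where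

  x∈p[x]≔inside : x ∈ p [ x ]≔ inside
  x∈p[x]≔inside = []≔-updates p x

  p⊆p[x]≔inside : p ⊆ p [ x ]≔ inside
  p⊆p[x]≔inside {y} y∈p with y ≟ x
  ... | yes refl = x∈p[x]≔inside
  ... | no y≢x   = []≔-minimal p y x y≢x y∈p

  ∈-[]≔inside⁻ : ∀ {y} → y ∈ p [ x ]≔ inside → y ≡ x ⊎ y ∈ p
  ∈-[]≔inside⁻ {y} y∈ with y ≟ x
  ... | yes y≡x = inj₁ y≡x
  ... | no y≢x  = inj₂ (lookup⇒[]= y p (trans (sym (lookup∘update′ y≢x p inside)) ([]=⇒lookup y∈)))

-- With P = Burned H B k this is exactly the second disjunct of Burned H B (suc k) v.
Burnable : (H : Hypergraph) → (Fin (n H) → Set) → Fin (n H) → Set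
Burnable H P v = ∃[ h ] v ∈ edge H h × (∀ u → u ∈ edge H h → u ≢ v → P u)

module _ (H : Hypergraph) where

  data Node : Fin (N (IG H)) → Set where
    vertex    : (v : Fin (n H)) → Node (v ↑ˡ m H)
    hyperedge : (h : Fin (m H)) → Node (n H ↑ʳ h)

  node : ∀ x → Node x
  node x with splitAt (n H) x in eq
  ... | inj₁ v = subst Node (splitAt⁻¹-↑ˡ eq) (vertex v)
  ... | inj₂ h = subst Node (splitAt⁻¹-↑ʳ eq) (hyperedge h)

  adj-hyperedge-vertex : ∀ h v → Adj (IG H) (n H ↑ʳ h) (v ↑ˡ m H) ≡ (v ∈ edge H h)
  adj-hyperedge-vertex h v = cong₂ (IGAdj′ H) (splitAt-↑ʳ (n H) (m H) h) (splitAt-↑ˡ (n H) v (m H))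

  ¬adj-vertex-vertex : ∀ u v → ¬ Adj (IG H) (u ↑ˡ m H) (v ↑ˡ m H)
  ¬adj-vertex-vertex u v rewrite splitAt-↑ˡ (n H) u (m H) | splitAt-↑ˡ (n H) v (m H) = λ ()

  vertex∈∪E : ∀ {S v} → v ∈ S → (v ↑ˡ m H) ∈ _∪E {H} S
  vertex∈∪E = []=-++⁺ˡ

  vertex∈∪E⁻ : ∀ {S v} → (v ↑ˡ m H) ∈ _∪E {H} S → v ∈ S
  vertex∈∪E⁻ = []=-++⁻ˡ

  hyperedge∈∪E : ∀ {S} h → (n H ↑ʳ h) ∈ _∪E {H} S
  hyperedge∈∪E {S} h = []=-++⁺ʳ S ([]=-replicate h)

  ∪E-allBlack : ∀ {S} → (∀ v → v ∈ S) → AllBlack (IG H) (_∪E {H} S)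
  ∪E-allBlack all x with node x
  ... | vertex v    = vertex∈∪E (all v)
  ... | hyperedge h = hyperedge∈∪E h

  burnable-mono : ∀ {P Q : Fin (n H) → Set} →
    (∀ {u} → P u → Q u) → ∀ {v} → Burnable H P v → Burnable H Q v
  burnable-mono P⊆Q (h , v∈h , rest) = h , v∈h , λ u u∈h u≢v → P⊆Q (rest u u∈h u≢v)

  burnable? : (S : Subset (n H)) → Decidable (Burnable H (_∈ S))
  burnable? S v = any? λ h → (v ∈? edge H h) ×-dec
    all? λ u → (u ∈? edge H h) →-dec (¬? (u ≟ v) →-dec (u ∈? S))

  hyperedge-forces : ∀ {S v} → v ∉ S → Burnable H (_∈ S) v →
    ForceStep (IG H) (_∪E {H} S) (_∪E {H} (S [ v ]≔ inside))
  hyperedge-forces {S} {v} v∉S (h , v∈h , rest) =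
    n H ↑ʳ h , v ↑ˡ m H , hyperedge∈∪E h , subst id (sym (adj-hyperedge-vertex h v)) v∈h ,
    v∉S ∘ vertex∈∪E⁻ , others , sym ([]≔-++-↑ˡ S (replicate (m H) inside) v)
    where
    others : ∀ x → Adj (IG H) (n H ↑ʳ h) x → x ≢ v ↑ˡ m H → x ∈ _∪E {H} S
    others x adj x≢v with node x
    ... | hyperedge h′ = hyperedge∈∪E h′
    ... | vertex u     =
      vertex∈∪E (rest u (subst id (adj-hyperedge-vertex h u) adj) (x≢v ∘ cong (_↑ˡ m H)))

  force-all : ∀ S ws → All (Burnable H (_∈ S)) ws →
    ∃[ S′ ] Star (ForceStep (IG H)) (_∪E {H} S) (_∪E {H} S′) × S ⊆ S′ × All (_∈ S′) ws
  force-all S []       []          = S , ε , ⊆-refl , []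
  force-all S (w ∷ ws) (bw ∷ bws) with w ∈? S
  ... | yes w∈S =
    let S′ , steps , S⊆S′ , ws⊆S′ = force-all S ws bws
    in  S′ , steps , S⊆S′ , S⊆S′ w∈S ∷ ws⊆S′
  ... | no w∉S =
    let S⊆S[w] = p⊆p[x]≔inside S w
        S′ , steps , S[w]⊆S′ , ws⊆S′ = force-all (S [ w ]≔ inside) ws (All.map (burnable-mono S⊆S[w]) bws)
    in  S′ , hyperedge-forces w∉S bw ◅ steps , ⊆-trans S⊆S[w] S[w]⊆S′ ,
        S[w]⊆S′ (x∈p[x]≔inside S w) ∷ ws⊆S′

  -- Each round forces, in one sweep, every vertex that is burnable from the current black set.
  force-rounds : ∀ B k →
    ∃[ S ] Star (ForceStep (IG H)) (_∪E {H} B) (_∪E {H} S) × (∀ {v} → Burned H B k v → v ∈ S)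
  force-rounds B zero    = B , ε , id
  force-rounds B (suc k) =
    let S , steps , burned⊆S = force-rounds B k
        S′ , steps′ , S⊆S′ , burnable⊆S′ =
          force-all S (filter (burnable? S) (allFin _)) (all-filter (burnable? S) (allFin _))
        burned⊆S′ : ∀ {v} → Burned H B (suc k) v → v ∈ S′
        burned⊆S′ = λ where
          (inj₁ b)          → S⊆S′ (burned⊆S b)
          {v} (inj₂ burns) → All.lookup burnable⊆S′
            (∈-filter⁺ (burnable? S) (∈-allFin v) (burnable-mono burned⊆S burns))
    in  S′ , steps ◅◅ steps′ , burned⊆S′

  lazyBurning⇒zeroForcing : ∀ B → IsLazyBurningSet H B → IsZeroForcingSet (IG H) (_∪E {H} B)
  lazyBurning⇒zeroForcing B (k , allBurned) =
    let S , steps , burned⊆S = force-rounds B k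
    in  _∪E {H} S , steps , ∪E-allBlack (λ v → burned⊆S (allBurned v))

  BlackBurns : Subset (n H) → Subset (N (IG H)) → Set
  BlackBurns B X = (∀ h → (n H ↑ʳ h) ∈ X) × ∃[ k ] ∀ v → (v ↑ˡ m H) ∈ X → Burned H B k v

  blackBurns-∪E : ∀ B → BlackBurns B (_∪E {H} B)
  blackBurns-∪E B = hyperedge∈∪E , zero , λ v → vertex∈∪E⁻

  -- Hyperedge nodes stay black, so the forced node is a vertex and the forcing node a hyperedge.
  forceStep-blackBurns : ∀ B → BlackBurns B Respects ForceStep (IG H)
  forceStep-blackBurns B {X} (u , w , _ , adj , w∉X , others , refl) (edges∈X , k , burns)
    with node w | node u
  ... | hyperedge h | _           = ⊥-elim (w∉X (edges∈X h))
  ... | vertex v    | vertex u′   = ⊥-elim (¬adj-vertex-vertex u′ v adj)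
  ... | vertex v    | hyperedge h = p⊆p[x]≔inside X _ ∘ edges∈X , suc k , burns′
    where
    v-burnable : Burnable H (Burned H B k) v
    v-burnable = h , subst id (adj-hyperedge-vertex h v) adj , λ u u∈h u≢v →
      burns u (others (u ↑ˡ m H) (subst id (sym (adj-hyperedge-vertex h u)) u∈h)
                      (u≢v ∘ ↑ˡ-injective (m H) u v))
    burns′ : ∀ v′ → (v′ ↑ˡ m H) ∈ X [ v ↑ˡ m H ]≔ inside → Burned H B (suc k) v′
    burns′ v′ v′∈ with ∈-[]≔inside⁻ X _ v′∈
    ... | inj₁ v′≡v rewrite ↑ˡ-injective (m H) v′ v v′≡v = inj₂ v-burnable
    ... | inj₂ v′∈X = inj₁ (burns v′ v′∈X)

  zeroForcing⇒lazyBurning : ∀ B → IsZeroForcingSet (IG H) (_∪E {H} B) → IsLazyBurningSet H B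
  zeroForcing⇒lazyBurning B (_ , steps , allBlack) =
    let _ , k , burns = Star-resp (forceStep-blackBurns B) steps (blackBurns-∪E B)
    in  k , λ v → burns v (allBlack _)

theorem4p1 : (H : Hypergraph) (B : Subset (n H)) →
    IsLazyBurningSet H B ⇔ IsZeroForcingSet (IG H) (_∪E {H} B)
theorem4p1 H B = mk⇔ (lazyBurning⇒zeroForcing H B) (zeroForcing⇒lazyBurning H B)
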